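{- For every positive integer $n$, $\beta_1(n)=\lceil\frac n2\rceil$.
   Context: For a positive integer $n$, $[n]=\{1,\dots,n\}$. For a set $D$ of integers and families $\mathcal{F},\mathcal{F}'$ of subsets of $[n]$, $\mathcal{F}'$ is called $D$-secting for $\mathcal{F}$ if for every $A\in\mathcal{F}$ there exists $A'\in\mathcal{F}'$ with $|A\cap A'|-|A\cap([n]\setminus A')|\in D$. $\beta_D(\mathcal{F})$ is the minimum cardinality of a $D$-secting family for $\mathcal{F}$, and $\beta_1(\mathcal{F})=\beta_D(\mathcal{F})$ for $D=\{1\}$. Since $|A\cap A'|-|A\cap([n]\setminus A')|$ has the parity of $|A|$, only subsets of odd cardinality are considered: $\beta_1(n)$ is the maximum of $\beta_1(\mathcal{F})$ over all families $\mathcal{F}$ of odd-cardinality subsets of $[n]$ (equivalently, $\beta_1$ of the family of all odd-cardinality subsets of $[n]$). -}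

module Defs where

open import Data.Nat using (ℕ; _%_)
open import Data.Integer using (ℤ; +_; _-_)
open import Data.Fin.Subset using (Subset; _∩_; ∁; ∣_∣)
open import Data.List using (List)
open import Data.List.Membership.Propositional using (_∈_)
open import Data.Product using (Σ-syntax; _×_)
open import Relation.Binary.PropositionalEquality using (_≡_)

sectVal : ∀ {n} → Subset n → Subset n → ℤ
sectVal A A' = + ∣ A ∩ A' ∣ - + ∣ A ∩ ∁ A' ∣

DSecting : ∀ {n} → (ℤ → Set) → (Subset n → Set) → List (Subset n) → Set
DSecting D F F' = ∀ A → F A → Σ[ A' ∈ _ ] (A' ∈ F' × D (sectVal A A'))

One : ℤ → Set
One z = z ≡ + 1

OddSet : ∀ {n} → Subset n → Set
OddSet A = ∣ A ∣ % 2 ≡ 1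

Beta1Is : ℕ → ℕ → Set
Beta1Is n m =
  (Σ[ F' ∈ List (Subset n) ] (Unique F' × length F' ≡ m × DSecting One OddSet F'))
  × (∀ (F' : List (Subset n)) → DSecting One OddSet F' → m ≤ length F')
  where
  open import Data.List using (length)
  open import Data.List.Relation.Unary.Unique.Propositional using (Unique)
  open import Data.Nat using (_≤_)

module Submission where

-- Upper bound: with K + L = n and K ≤ L ≤ K + 2, the K + 1 windows {s, …, s + L - 1}, s ≤ K, are
-- 1-secting. For an odd set A, ∣A∣ = 2m + 1, the number of points of A in the window changes by at
-- most one as the window slides, and the first and last windows cover [n] and overlap in at most
-- two points, so together they contain between 2m + 1 and 2m + 3 points of A. Hence one of the
-- windows W contains exactly m + 1 of them, i.e. ∣A ∩ W∣ - ∣A ∖ W∣ = 1.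
--
-- Lower bound (polynomial method): if F' is 1-secting and ∣F'∣ < ⌈n/2⌉, then
--   P(x) = ∏_{1 ≤ j ≤ ⌊n/2⌋} (∣x∣ - 2j) · ∏_{A' ∈ F'} (sectVal x A' - 1)
-- is a product of fewer than n affine functions of the coordinates of x ∈ {0,1}ⁿ, and it vanishes
-- at every nonempty x (even ones by the first product, odd ones by the second) but not at ∅.
-- So Σₓ (-1)^∣x∣ P(x) = P(∅) ≠ 0, whereas this alternating sum is 0 for every polynomial of degree
-- less than n, because it equals minus the alternating sum of the difference in one coordinate,
-- which has smaller degree in fewer variables.

open import Defs
open import Data.Nat using (ℕ; zero; suc; pred; _≤_; _<_; z≤n; s≤s; s≤s⁻¹; ⌈_/2⌉)
open import Data.Bool using (true; false; if_then_else_)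
open import Data.Vec.Base using ([]; _∷_; tail; here; there)
open import Data.Fin using (Fin; zero; suc; toℕ; fromℕ<)
open import Data.Fin.Properties using (toℕ<n; toℕ-fromℕ<; toℕ-injective)
open import Data.Fin.Subset using (Subset; _∩_; _∪_; ∁; ∣_∣; ⊥; ⊤; _⊆_; _∈_; inside; outside)
open import Data.Fin.Subset.Properties
  using (⊆-reflexive; p⊆q⇒∣p∣≤∣q∣; ∣p∩q∣≤∣q∣; ∣p∣≤n; x∈p∩q⁺; x∈p∩q⁻; x∈p∪q⁺; x∈p∪q⁻; ∩-identityʳ)
open import Data.List using (List; []; _∷_; length; _++_; map; upTo; allFin)
open import Data.List.Properties using (length-++; length-map; length-upTo; length-tabulate)
open import Data.List.Membership.Propositional using (lose) renaming (_∈_ to _∈ₗ_)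
open import Data.List.Membership.Propositional.Properties using (∈-map⁺; ∈-upTo⁺; ∈-allFin)
open import Data.List.Relation.Unary.All using (All; []; _∷_; universal)
import Data.List.Relation.Unary.All.Properties as All
open import Data.List.Relation.Unary.Any using (Any; here; there)
import Data.List.Relation.Unary.Any.Properties as Any
open import Data.List.Relation.Unary.Unique.Propositional using (Unique)
import Data.List.Relation.Unary.Unique.Propositional.Properties as Unique
open import Data.Product as Product using (_×_; _,_; Σ-syntax; proj₁; proj₂)
open import Data.Sum as Sum using (_⊎_; inj₁; inj₂; [_,_]′)
open import Function using (_∘_)
open import Relation.Binary.PropositionalEquality
open import Relation.Nullary using (¬_; yes; no; contradiction)

module CubePolynomials where

  open import Data.Integer using (ℤ; +_; 0ℤ; 1ℤ; -1ℤ; _+_; _-_; _*_; -_)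
  open import Data.Integer.Properties
    using (+-assoc; +-identityˡ; +-identityʳ; +-inverseʳ; *-zeroˡ; *-zeroʳ; *-distribʳ-+; i*j≡0⇒i≡0∨j≡0)
  open import Data.Integer.Tactic.RingSolver using (solve-∀)
  open ≡-Reasoning

  alternatingSum : ∀ {n} → (Subset n → ℤ) → ℤ
  alternatingSum {zero}  f = f []
  alternatingSum {suc n} f = alternatingSum (f ∘ (false ∷_)) - alternatingSum (f ∘ (true ∷_))

  alternatingSum-cong : ∀ {n} {f g : Subset n → ℤ} → f ≗ g → alternatingSum f ≡ alternatingSum g
  alternatingSum-cong {zero}  f≗g = f≗g []
  alternatingSum-cong {suc n} f≗g =
    cong₂ _-_ (alternatingSum-cong (f≗g ∘ (false ∷_))) (alternatingSum-cong (f≗g ∘ (true ∷_)))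

  alternatingSum-0 : ∀ {n} → alternatingSum {n} (λ _ → 0ℤ) ≡ 0ℤ
  alternatingSum-0 {zero}  = refl
  alternatingSum-0 {suc n} rewrite alternatingSum-0 {n} = refl

  alternatingSum-sub : ∀ {n} (f g : Subset n → ℤ) →
                       alternatingSum (λ x → f x - g x) ≡ alternatingSum f - alternatingSum g
  alternatingSum-sub {zero}  f g = refl
  alternatingSum-sub {suc n} f g = begin
    alternatingSum (λ y → f₀ y - g₀ y) - alternatingSum (λ y → f₁ y - g₁ y)
      ≡⟨ cong₂ _-_ (alternatingSum-sub f₀ g₀) (alternatingSum-sub f₁ g₁) ⟩
    (alternatingSum f₀ - alternatingSum g₀) - (alternatingSum f₁ - alternatingSum g₁)
      ≡⟨ interchange (alternatingSum f₀) (alternatingSum g₀) (alternatingSum f₁) (alternatingSum g₁) ⟩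
    (alternatingSum f₀ - alternatingSum f₁) - (alternatingSum g₀ - alternatingSum g₁) ∎
    where
    f₀ = f ∘ (false ∷_)
    f₁ = f ∘ (true ∷_)
    g₀ = g ∘ (false ∷_)
    g₁ = g ∘ (true ∷_)
    interchange : ∀ a b c d → (a - b) - (c - d) ≡ (a - c) - (b - d)
    interchange = solve-∀

  alternatingSum-point : ∀ {n} (f : Subset n → ℤ) → (∀ x → ¬ x ≡ ⊥ → f x ≡ 0ℤ) → alternatingSum f ≡ f ⊥
  alternatingSum-point {zero}  f _   = refl
  alternatingSum-point {suc n} f f≡0 = begin
    alternatingSum (f ∘ (false ∷_)) - alternatingSum (f ∘ (true ∷_))
      ≡⟨ cong₂ _-_ (alternatingSum-point (f ∘ (false ∷_)) (λ y y≢⊥ → f≡0 _ (y≢⊥ ∘ cong tail)))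
                   (alternatingSum-cong (λ y → f≡0 (true ∷ y) λ ())) ⟩
    f ⊥ - alternatingSum {n} (λ _ → 0ℤ) ≡⟨ cong (λ t → f ⊥ - t) (alternatingSum-0 {n}) ⟩
    f ⊥ - 0ℤ                            ≡⟨ +-identityʳ (f ⊥) ⟩
    f ⊥                                 ∎

  Affine : ℕ → Set
  Affine zero    = ℤ
  Affine (suc n) = ℤ × Affine n

  -- (w₁ , … , wₙ , c) denotes x ↦ c + Σ_{i ∈ x} wᵢ
  ⟦_⟧ : ∀ {n} → Affine n → Subset n → ℤ
  ⟦_⟧ {zero}  c       []      = c
  ⟦_⟧ {suc n} (w , L) (b ∷ x) = if b then w + ⟦ L ⟧ x else ⟦ L ⟧ x

  data Degree≤ {n} : ℕ → (Subset n → ℤ) → Set where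
    const     : ∀ {m} c → Degree≤ m (λ _ → c)
    lift      : ∀ {m f} → Degree≤ m f → Degree≤ (suc m) f
    add       : ∀ {m f g} → Degree≤ m f → Degree≤ m g → Degree≤ m (λ x → f x + g x)
    scale     : ∀ {m f} c → Degree≤ m f → Degree≤ m (λ x → c * f x)
    mulAffine : ∀ {m f} (L : Affine n) → Degree≤ m f → Degree≤ (suc m) (λ x → ⟦ L ⟧ x * f x)
    respect   : ∀ {m f g} → Degree≤ m f → f ≗ g → Degree≤ m g

  restrict : ∀ {n m f} b → Degree≤ {suc n} m f → Degree≤ m (f ∘ (b ∷_))
  restrict b     (const c)   = const c
  restrict b     (lift d)    = lift (restrict b d)
  restrict b     (add d e)   = add (restrict b d) (restrict b e)
  restrict b     (scale c d) = scale c (restrict b d)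
  restrict false (mulAffine (w , L) d) = mulAffine L (restrict false d)
  restrict true  (mulAffine {f = g} (w , L) d) =
    respect (add (lift (scale w (restrict true d))) (mulAffine L (restrict true d)))
            (λ y → sym (*-distribʳ-+ (g (true ∷ y)) w (⟦ L ⟧ y)))
  restrict b     (respect d f≗g) = respect (restrict b d) (f≗g ∘ (b ∷_))

  Degree≤0⇒constant : ∀ {n f} → Degree≤ {n} 0 f → ∀ x y → f x ≡ f y
  Degree≤0⇒constant (const c)       x y = refl
  Degree≤0⇒constant (add d e)       x y = cong₂ _+_ (Degree≤0⇒constant d x y) (Degree≤0⇒constant e x y)
  Degree≤0⇒constant (scale c d)     x y = cong (c *_) (Degree≤0⇒constant d x y)
  Degree≤0⇒constant (respect d f≗g) x y = trans (sym (f≗g x)) (trans (Degree≤0⇒constant d x y) (f≗g y))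

  Δ : ∀ {n} → (Subset (suc n) → ℤ) → Subset n → ℤ
  Δ f y = f (true ∷ y) - f (false ∷ y)

  lift-pred : ∀ {n m f} → Degree≤ {n} (pred m) f → Degree≤ m f
  lift-pred {m = zero}  d = d
  lift-pred {m = suc m} d = lift d

  Δ-degree : ∀ {n m f} → Degree≤ {suc n} m f → Degree≤ (pred m) (Δ f)
  Δ-degree (const c) = respect (const 0ℤ) (λ _ → sym (+-inverseʳ c))
  Δ-degree (lift d)  = lift-pred (Δ-degree d)
  Δ-degree (add {f = f} {g} d e) =
    respect (add (Δ-degree d) (Δ-degree e))
            (λ y → Δ-add (f (true ∷ y)) (f (false ∷ y)) (g (true ∷ y)) (g (false ∷ y)))
    where
    Δ-add : ∀ a b c d → (a - b) + (c - d) ≡ (a + c) - (b + d)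
    Δ-add = solve-∀
  Δ-degree (scale {f = f} c d) =
    respect (scale c (Δ-degree d)) (λ y → Δ-scale c (f (true ∷ y)) (f (false ∷ y)))
    where
    Δ-scale : ∀ c a b → c * (a - b) ≡ c * a - c * b
    Δ-scale = solve-∀
  Δ-degree (mulAffine {m = zero} {f = g} (w , L) d) = respect (scale w (restrict true d)) Δ-mul₀
    where
    ring : ∀ w l a → w * a ≡ (w + l) * a - l * a
    ring = solve-∀
    Δ-mul₀ : ∀ y → w * g (true ∷ y) ≡ (w + ⟦ L ⟧ y) * g (true ∷ y) - ⟦ L ⟧ y * g (false ∷ y)
    Δ-mul₀ y rewrite Degree≤0⇒constant d (false ∷ y) (true ∷ y) = ring w (⟦ L ⟧ y) (g (true ∷ y))
  Δ-degree (mulAffine {m = suc m} {f = g} (w , L) d) =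
    respect (add (scale w (restrict true d)) (mulAffine L (Δ-degree d)))
            (λ y → Δ-mul w (⟦ L ⟧ y) (g (true ∷ y)) (g (false ∷ y)))
    where
    Δ-mul : ∀ w l a b → w * a + l * (a - b) ≡ (w + l) * a - l * b
    Δ-mul = solve-∀
  Δ-degree (respect d f≗g) = respect (Δ-degree d) (λ y → cong₂ _-_ (f≗g _) (f≗g _))

  alternatingSum-Δ : ∀ {n} (f : Subset (suc n) → ℤ) → alternatingSum f ≡ - alternatingSum (Δ f)
  alternatingSum-Δ f = begin
    a₀ - a₁                                   ≡⟨ swap-sub a₀ a₁ ⟩
    - (a₁ - a₀)                               ≡⟨ cong -_ (alternatingSum-sub (f ∘ (true ∷_)) (f ∘ (false ∷_))) ⟨
    - alternatingSum (Δ f)                    ∎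
    where
    a₀ = alternatingSum (f ∘ (false ∷_))
    a₁ = alternatingSum (f ∘ (true ∷_))
    swap-sub : ∀ a b → a - b ≡ - (b - a)
    swap-sub = solve-∀

  alternatingSum-vanishes : ∀ {n m f} → Degree≤ {n} m f → m < n → alternatingSum f ≡ 0ℤ
  alternatingSum-vanishes {suc n} {zero} {f} d _ = begin
    alternatingSum f                ≡⟨ alternatingSum-Δ f ⟩
    - alternatingSum (Δ f)          ≡⟨ cong -_ (alternatingSum-cong Δf≡0) ⟩
    - alternatingSum {n} (λ _ → 0ℤ) ≡⟨ cong -_ (alternatingSum-0 {n}) ⟩
    0ℤ                              ∎
    where
    Δf≡0 : ∀ y → Δ f y ≡ 0ℤ
    Δf≡0 y = trans (cong (_- f (false ∷ y)) (Degree≤0⇒constant d (true ∷ y) (false ∷ y)))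
                   (+-inverseʳ (f (false ∷ y)))
  alternatingSum-vanishes {suc n} {suc m} {f} d (s≤s m<n) = begin
    alternatingSum f       ≡⟨ alternatingSum-Δ f ⟩
    - alternatingSum (Δ f) ≡⟨ cong -_ (alternatingSum-vanishes (Δ-degree d) m<n) ⟩
    0ℤ                     ∎

  ∏ : ∀ {n} → List (Affine n) → Subset n → ℤ
  ∏ []       _ = 1ℤ
  ∏ (L ∷ Ls) x = ⟦ L ⟧ x * ∏ Ls x

  ∏-degree : ∀ {n} (Ls : List (Affine n)) → Degree≤ (length Ls) (∏ Ls)
  ∏-degree []       = const 1ℤ
  ∏-degree (L ∷ Ls) = mulAffine L (∏-degree Ls)

  ∏-zero : ∀ {n} {Ls : List (Affine n)} {x} → Any (λ L → ⟦ L ⟧ x ≡ 0ℤ) Ls → ∏ Ls x ≡ 0ℤ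
  ∏-zero {Ls = L ∷ Ls} {x} (here L≡0)  = trans (cong (_* ∏ Ls x) L≡0) (*-zeroˡ (∏ Ls x))
  ∏-zero {Ls = L ∷ Ls} {x} (there any) = trans (cong (⟦ L ⟧ x *_) (∏-zero any)) (*-zeroʳ (⟦ L ⟧ x))

  ∏-nonzero : ∀ {n} {Ls : List (Affine n)} {x} → All (λ L → ¬ ⟦ L ⟧ x ≡ 0ℤ) Ls → ¬ ∏ Ls x ≡ 0ℤ
  ∏-nonzero []             = λ ()
  ∏-nonzero (L≢0 ∷ Ls≢0) = [ L≢0 , ∏-nonzero Ls≢0 ]′ ∘ i*j≡0⇒i≡0∨j≡0 _

  sizeMinus : ∀ {n} → ℕ → Affine n
  sizeMinus {zero}  k = - + k
  sizeMinus {suc n} k = 1ℤ , sizeMinus k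

  ⟦sizeMinus⟧ : ∀ {n} k (x : Subset n) → ⟦ sizeMinus k ⟧ x ≡ + ∣ x ∣ - + k
  ⟦sizeMinus⟧ k []          = sym (+-identityˡ (- + k))
  ⟦sizeMinus⟧ k (false ∷ x) = ⟦sizeMinus⟧ k x
  ⟦sizeMinus⟧ k (true ∷ x)  = trans (cong (λ t → 1ℤ + t) (⟦sizeMinus⟧ k x)) (sym (+-assoc 1ℤ (+ ∣ x ∣) (- + k)))

  ⟦sizeMinus⟧-⊥ : ∀ {n} k → ⟦ sizeMinus {n} k ⟧ ⊥ ≡ - + k
  ⟦sizeMinus⟧-⊥ {zero}  k = refl
  ⟦sizeMinus⟧-⊥ {suc n} k = ⟦sizeMinus⟧-⊥ {n} k

  sectAffine : ∀ {n} → Subset n → Affine n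
  sectAffine []      = -1ℤ
  sectAffine (a ∷ A) = (if a then 1ℤ else -1ℤ) , sectAffine A

  ⟦sectAffine⟧ : ∀ {n} (A x : Subset n) → ⟦ sectAffine A ⟧ x ≡ sectVal x A - 1ℤ
  ⟦sectAffine⟧ []          []          = refl
  ⟦sectAffine⟧ (a ∷ A)     (false ∷ x) = ⟦sectAffine⟧ A x
  ⟦sectAffine⟧ (true ∷ A)  (true ∷ x)  =
    trans (cong (λ t → 1ℤ + t) (⟦sectAffine⟧ A x)) (inside-step (+ ∣ x ∩ A ∣) (+ ∣ x ∩ ∁ A ∣))
    where
    inside-step : ∀ p q → 1ℤ + (p - q - 1ℤ) ≡ (1ℤ + p - q) - 1ℤ
    inside-step = solve-∀
  ⟦sectAffine⟧ (false ∷ A) (true ∷ x)  =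
    trans (cong (λ t → -1ℤ + t) (⟦sectAffine⟧ A x)) (outside-step (+ ∣ x ∩ A ∣) (+ ∣ x ∩ ∁ A ∣))
    where
    outside-step : ∀ p q → -1ℤ + (p - q - 1ℤ) ≡ (p - (1ℤ + q)) - 1ℤ
    outside-step = solve-∀

  ⟦sectAffine⟧-⊥ : ∀ {n} (A : Subset n) → ⟦ sectAffine A ⟧ ⊥ ≡ -1ℤ
  ⟦sectAffine⟧-⊥ []      = refl
  ⟦sectAffine⟧-⊥ (a ∷ A) = ⟦sectAffine⟧-⊥ A

open CubePolynomials

open import Data.Nat using (_+_; _∸_; _%_; _/_; ⌊_/2⌋; _≟_; _<?_)
open import Data.Nat.Properties
open import Data.Nat.DivMod using (m≡m%n+[m/n]*n; m%n<n)
open import Data.Nat.Tactic.RingSolver using (solve-∀)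
open import Data.Integer as ℤ using (_⊖_; 0ℤ; 1ℤ)
import Data.Integer.Properties as ℤ

k≡k%2+[k/2+k/2] : ∀ k → k ≡ k % 2 + (k / 2 + k / 2)
k≡k%2+[k/2+k/2] k =
  trans (m≡m%n+[m/n]*n k 2) (cong (k % 2 +_) (trans (*-comm (k / 2) 2) (cong (k / 2 +_) (+-identityʳ (k / 2)))))

k%2≡1⇒k≡1+[k/2+k/2] : ∀ {k} → k % 2 ≡ 1 → k ≡ suc (k / 2 + k / 2)
k%2≡1⇒k≡1+[k/2+k/2] {k} k%2≡1 = trans (k≡k%2+[k/2+k/2] k) (cong (_+ (k / 2 + k / 2)) k%2≡1)

k%2≢1⇒k≡k/2+k/2 : ∀ {k} → ¬ k % 2 ≡ 1 → k ≡ k / 2 + k / 2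
k%2≢1⇒k≡k/2+k/2 {k} k%2≢1 =
  trans (k≡k%2+[k/2+k/2] k) (cong (_+ (k / 2 + k / 2)) (r≡0 (k % 2) (m%n<n k 2) k%2≢1))
  where
  r≡0 : ∀ r → r < 2 → ¬ r ≡ 1 → r ≡ 0
  r≡0 0             _                _   = refl
  r≡0 1             _                r≢1 = contradiction refl r≢1
  r≡0 (suc (suc _)) (s≤s (s≤s ())) _

+<+⇒<⊎< : ∀ {x y a b} → x + y < a + b → x < a ⊎ y < b
+<+⇒<⊎< {x} {y} {a} {b} x+y<a+b with x <? a | y <? b
... | yes x<a | _       = inj₁ x<a
... | no _    | yes y<b = inj₂ y<b
... | no x≮a  | no y≮b  = contradiction (+-mono-≤ (≮⇒≥ x≮a) (≮⇒≥ y≮b)) (<⇒≱ x+y<a+b)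

Between : ℕ → ℕ → ℕ → Set
Between t a b = (t ≤ a ⊎ t ≤ b) × (a ≤ t ⊎ b ≤ t)

module _ (h : ℕ → ℕ) (step↑ : ∀ s → h (suc s) ≤ suc (h s)) (step↓ : ∀ s → h s ≤ suc (h (suc s))) where

  discrete-intermediate-value : ∀ K {t} → Between t (h 0) (h K) → Σ[ s ∈ ℕ ] s ≤ K × h s ≡ t
  discrete-intermediate-value zero (t≤ , ≤t) = 0 , z≤n , ≤-antisym (Sum.reduce ≤t) (Sum.reduce t≤)
  discrete-intermediate-value (suc K) {t} (t≤ , ≤t) with h (suc K) ≟ t
  ... | yes hK+1≡t = suc K , ≤-refl , hK+1≡t
  ... | no hK+1≢t  =
    let s , s≤K , hs≡t = discrete-intermediate-value K (Sum.map₂ below t≤ , Sum.map₂ above ≤t)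
    in  s , m≤n⇒m≤1+n s≤K , hs≡t
    where
    below : t ≤ h (suc K) → t ≤ h K
    below t≤hK+1 = s≤s⁻¹ (≤-trans (≤∧≢⇒< t≤hK+1 (hK+1≢t ∘ sym)) (step↑ K))
    above : h (suc K) ≤ t → h K ≤ t
    above hK+1≤t = ≤-trans (step↓ K) (≤∧≢⇒< hK+1≤t hK+1≢t)

∣p∣≡0⇒p≡⊥ : ∀ {n} {p : Subset n} → ∣ p ∣ ≡ 0 → p ≡ ⊥
∣p∣≡0⇒p≡⊥ {p = []}          _      = refl
∣p∣≡0⇒p≡⊥ {p = outside ∷ p} ∣p∣≡0 = cong (outside ∷_) (∣p∣≡0⇒p≡⊥ ∣p∣≡0)

∣p∩q∣+∣p∩∁q∣≡∣p∣ : ∀ {n} (p q : Subset n) → ∣ p ∩ q ∣ + ∣ p ∩ ∁ q ∣ ≡ ∣ p ∣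
∣p∩q∣+∣p∩∁q∣≡∣p∣ []            []            = refl
∣p∩q∣+∣p∩∁q∣≡∣p∣ (outside ∷ p) (_       ∷ q) = ∣p∩q∣+∣p∩∁q∣≡∣p∣ p q
∣p∩q∣+∣p∩∁q∣≡∣p∣ (inside  ∷ p) (inside  ∷ q) = cong suc (∣p∩q∣+∣p∩∁q∣≡∣p∣ p q)
∣p∩q∣+∣p∩∁q∣≡∣p∣ (inside  ∷ p) (outside ∷ q) = trans (+-suc _ _) (cong suc (∣p∩q∣+∣p∩∁q∣≡∣p∣ p q))

∣p∣+∣q∣≡∣p∪q∣+∣p∩q∣ : ∀ {n} (p q : Subset n) → ∣ p ∣ + ∣ q ∣ ≡ ∣ p ∪ q ∣ + ∣ p ∩ q ∣
∣p∣+∣q∣≡∣p∪q∣+∣p∩q∣ []            []            = refl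
∣p∣+∣q∣≡∣p∪q∣+∣p∩q∣ (outside ∷ p) (outside ∷ q) = ∣p∣+∣q∣≡∣p∪q∣+∣p∩q∣ p q
∣p∣+∣q∣≡∣p∪q∣+∣p∩q∣ (outside ∷ p) (inside  ∷ q) = trans (+-suc ∣ p ∣ ∣ q ∣) (cong suc (∣p∣+∣q∣≡∣p∪q∣+∣p∩q∣ p q))
∣p∣+∣q∣≡∣p∪q∣+∣p∩q∣ (inside  ∷ p) (outside ∷ q) = cong suc (∣p∣+∣q∣≡∣p∪q∣+∣p∩q∣ p q)
∣p∣+∣q∣≡∣p∪q∣+∣p∩q∣ (inside  ∷ p) (inside  ∷ q) =
  cong suc (trans (+-suc ∣ p ∣ ∣ q ∣)
                  (trans (cong suc (∣p∣+∣q∣≡∣p∪q∣+∣p∩q∣ p q)) (sym (+-suc ∣ p ∪ q ∣ ∣ p ∩ q ∣))))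

∣p∪q∣≤∣p∣+∣q∣ : ∀ {n} (p q : Subset n) → ∣ p ∪ q ∣ ≤ ∣ p ∣ + ∣ q ∣
∣p∪q∣≤∣p∣+∣q∣ p q = ≤-trans (m≤m+n ∣ p ∪ q ∣ ∣ p ∩ q ∣) (≤-reflexive (sym (∣p∣+∣q∣≡∣p∪q∣+∣p∩q∣ p q)))

∣A∩p∣≤∣A∩q∣+∣A∩r∣ : ∀ {n} (A : Subset n) {p q r} → (∀ {i} → i ∈ p → i ∈ q ⊎ i ∈ r) →
                    ∣ A ∩ p ∣ ≤ ∣ A ∩ q ∣ + ∣ A ∩ r ∣
∣A∩p∣≤∣A∩q∣+∣A∩r∣ A {p} {q} {r} p⊆q∪r =
  ≤-trans (p⊆q⇒∣p∣≤∣q∣ A∩p⊆A∩q∪A∩r) (∣p∪q∣≤∣p∣+∣q∣ (A ∩ q) (A ∩ r))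
  where
  A∩p⊆A∩q∪A∩r : A ∩ p ⊆ (A ∩ q) ∪ (A ∩ r)
  A∩p⊆A∩q∪A∩r i∈A∩p =
    let i∈A , i∈p = x∈p∩q⁻ A p i∈A∩p
    in  x∈p∪q⁺ (Sum.map (x∈p∩q⁺ ∘ (i∈A ,_)) (x∈p∩q⁺ ∘ (i∈A ,_)) (p⊆q∪r i∈p))

∣A∩p∣+∣A∩q∣≤∣A∣+∣p∩q∣ : ∀ {n} (A p q : Subset n) → ∣ A ∩ p ∣ + ∣ A ∩ q ∣ ≤ ∣ A ∣ + ∣ p ∩ q ∣
∣A∩p∣+∣A∩q∣≤∣A∣+∣p∩q∣ A p q =
  ≤-trans (≤-reflexive (∣p∣+∣q∣≡∣p∪q∣+∣p∩q∣ (A ∩ p) (A ∩ q)))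
          (+-mono-≤ (p⊆q⇒∣p∣≤∣q∣ ∪⊆A) (p⊆q⇒∣p∣≤∣q∣ ∩⊆p∩q))
  where
  ∪⊆A : (A ∩ p) ∪ (A ∩ q) ⊆ A
  ∪⊆A = Sum.[ proj₁ ∘ x∈p∩q⁻ A p , proj₁ ∘ x∈p∩q⁻ A q ] ∘ x∈p∪q⁻ (A ∩ p) (A ∩ q)
  ∩⊆p∩q : (A ∩ p) ∩ (A ∩ q) ⊆ p ∩ q
  ∩⊆p∩q i∈ = let i∈A∩p , i∈A∩q = x∈p∩q⁻ (A ∩ p) (A ∩ q) i∈
             in  x∈p∩q⁺ (proj₂ (x∈p∩q⁻ A p i∈A∩p) , proj₂ (x∈p∩q⁻ A q i∈A∩q))

sectVal≡1 : ∀ {n} (A W : Subset n) {m} → ∣ A ∣ ≡ suc (m + m) → ∣ A ∩ W ∣ ≡ suc m → sectVal A W ≡ ℤ.+ 1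
sectVal≡1 A W {m} ∣A∣≡1+2m ∣A∩W∣≡1+m = begin
  ℤ.+ ∣ A ∩ W ∣ ℤ.- ℤ.+ ∣ A ∩ ∁ W ∣ ≡⟨ cong₂ (λ i j → ℤ.+ i ℤ.- ℤ.+ j) ∣A∩W∣≡1+m ∣A∩∁W∣≡m ⟩
  ℤ.+ suc m ℤ.- ℤ.+ m               ≡⟨ ℤ.[+m]-[+n]≡m⊖n (suc m) m ⟩
  suc m ⊖ m                         ≡⟨ ℤ.⊖-≥ (n≤1+n m) ⟩
  ℤ.+ (suc m ∸ m)                   ≡⟨ cong ℤ.+_ (m+n∸n≡m 1 m) ⟩
  ℤ.+ 1                             ∎
  where
  open ≡-Reasoning
  ∣A∩∁W∣≡m : ∣ A ∩ ∁ W ∣ ≡ m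
  ∣A∩∁W∣≡m = +-cancelˡ-≡ (suc m) _ _ (begin
    suc m + ∣ A ∩ ∁ W ∣         ≡⟨ cong (_+ ∣ A ∩ ∁ W ∣) ∣A∩W∣≡1+m ⟨
    ∣ A ∩ W ∣ + ∣ A ∩ ∁ W ∣     ≡⟨ ∣p∩q∣+∣p∩∁q∣≡∣p∣ A W ⟩
    ∣ A ∣                       ≡⟨ ∣A∣≡1+2m ⟩
    suc m + m                   ∎)

interval : ∀ {n} → ℕ → ℕ → Subset n
interval {zero}  _       _       = []
interval {suc n} zero    zero    = outside ∷ interval 0 0
interval {suc n} zero    (suc b) = inside  ∷ interval 0 b
interval {suc n} (suc a) zero    = outside ∷ interval a 0
interval {suc n} (suc a) (suc b) = outside ∷ interval a b

∈-interval⁺ : ∀ {n a b} {i : Fin n} → a ≤ toℕ i → toℕ i < b → i ∈ interval a b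
∈-interval⁺ {a = zero}  {suc b} {zero}  _         _         = here
∈-interval⁺ {a = zero}  {suc b} {suc i} _         (s≤s i<b) = there (∈-interval⁺ z≤n i<b)
∈-interval⁺ {a = suc a} {suc b} {suc i} (s≤s a≤i) (s≤s i<b) = there (∈-interval⁺ a≤i i<b)

∈-interval⁻ : ∀ {n a b} {i : Fin n} → i ∈ interval a b → a ≤ toℕ i × toℕ i < b
∈-interval⁻ {a = zero}  {zero}  {suc i} (there i∈) = contradiction (proj₂ (∈-interval⁻ i∈)) n≮0
∈-interval⁻ {a = zero}  {suc b} {zero}  here       = z≤n , s≤s z≤n
∈-interval⁻ {a = zero}  {suc b} {suc i} (there i∈) = z≤n , s≤s (proj₂ (∈-interval⁻ i∈))
∈-interval⁻ {a = suc a} {zero}  {suc i} (there i∈) = contradiction (proj₂ (∈-interval⁻ i∈)) n≮0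
∈-interval⁻ {a = suc a} {suc b} {suc i} (there i∈) = Product.map s≤s s≤s (∈-interval⁻ i∈)

∣interval∣≤ : ∀ {n} a b → ∣ interval {n} a b ∣ ≤ b ∸ a
∣interval∣≤ {zero}  _       _       = z≤n
∣interval∣≤ {suc n} zero    zero    = ∣interval∣≤ {n} 0 0
∣interval∣≤ {suc n} zero    (suc b) = s≤s (∣interval∣≤ {n} 0 b)
∣interval∣≤ {suc n} (suc a) zero    = ≤-trans (∣interval∣≤ {n} a 0) (≤-reflexive (0∸n≡0 a))
∣interval∣≤ {suc n} (suc a) (suc b) = ∣interval∣≤ {n} a b

interval-split : ∀ {n a c} b {i : Fin n} → i ∈ interval a c → i ∈ interval a b ⊎ i ∈ interval b c
interval-split b {i} i∈ with ∈-interval⁻ i∈ | toℕ i <? b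
... | a≤i , _   | yes i<b = inj₁ (∈-interval⁺ a≤i i<b)
... | _   , i<c | no i≮b  = inj₂ (∈-interval⁺ (≮⇒≥ i≮b) i<c)

interval-mono : ∀ {n a b c d} {i : Fin n} → c ≤ a → b ≤ d → i ∈ interval a b → i ∈ interval c d
interval-mono c≤a b≤d i∈ = let a≤i , i<b = ∈-interval⁻ i∈ in ∈-interval⁺ (≤-trans c≤a a≤i) (<-≤-trans i<b b≤d)

module SlidingWindows {n} (K L : ℕ) (K+L≡n : K + L ≡ n) (K≤L : K ≤ L) (L≤2+K : L ≤ 2 + K) (0<L : 0 < L) where

  window : ℕ → Subset n
  window s = interval s (s + L)

  module _ (A : Subset n) where

    hits : ℕ → ℕ
    hits s = ∣ A ∩ window s ∣

    ∣A∩point∣≤1 : ∀ j → ∣ A ∩ interval j (suc j) ∣ ≤ 1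
    ∣A∩point∣≤1 j = ≤-trans (∣p∩q∣≤∣q∣ A _) (≤-trans (∣interval∣≤ {n} j (suc j)) (≤-reflexive (m+n∸n≡m 1 j)))

    hits-suc≤ : ∀ s → hits (suc s) ≤ suc (hits s)
    hits-suc≤ s = ≤-trans
      (∣A∩p∣≤∣A∩q∣+∣A∩r∣ A (Sum.swap ∘ interval-split (s + L) ∘ interval-mono (n≤1+n s) ≤-refl))
      (+-monoˡ-≤ (hits s) (∣A∩point∣≤1 (s + L)))

    hits≤suc : ∀ s → hits s ≤ suc (hits (suc s))
    hits≤suc s = ≤-trans
      (∣A∩p∣≤∣A∩q∣+∣A∩r∣ A (interval-split (suc s) ∘ interval-mono ≤-refl (n≤1+n (s + L))))
      (+-monoˡ-≤ (hits (suc s)) (∣A∩point∣≤1 s))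

    ∣A∣≤hits0+hitsK : ∣ A ∣ ≤ hits 0 + hits K
    ∣A∣≤hits0+hitsK = ≤-trans (≤-reflexive (cong ∣_∣ (sym (∩-identityʳ A)))) (∣A∩p∣≤∣A∩q∣+∣A∩r∣ A covered)
      where
      covered : ∀ {i} → i ∈ ⊤ → i ∈ window 0 ⊎ i ∈ window K
      covered {i} _ with toℕ i <? L
      ... | yes i<L = inj₁ (∈-interval⁺ z≤n i<L)
      ... | no  i≮L = inj₂ (∈-interval⁺ (≤-trans K≤L (≮⇒≥ i≮L)) (subst (toℕ i <_) (sym K+L≡n) (toℕ<n i)))

    hits0+hitsK≤∣A∣+2 : hits 0 + hits K ≤ ∣ A ∣ + 2
    hits0+hitsK≤∣A∣+2 =
      ≤-trans (∣A∩p∣+∣A∩q∣≤∣A∣+∣p∩q∣ A (window 0) (window K)) (+-monoʳ-≤ ∣ A ∣ ∣W₀∩Wₖ∣≤2)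
      where
      ∣W₀∩Wₖ∣≤2 : ∣ window 0 ∩ window K ∣ ≤ 2
      ∣W₀∩Wₖ∣≤2 =
        ≤-trans (p⊆q⇒∣p∣≤∣q∣ ∩⊆middle) (≤-trans (∣interval∣≤ {n} K (2 + K)) (≤-reflexive (m+n∸n≡m 2 K)))
        where
        ∩⊆middle : window 0 ∩ window K ⊆ interval K (2 + K)
        ∩⊆middle i∈ = let i∈W₀ , i∈Wₖ = x∈p∩q⁻ (window 0) (window K) i∈
                      in  ∈-interval⁺ (proj₁ (∈-interval⁻ i∈Wₖ)) (<-≤-trans (proj₂ (∈-interval⁻ i∈W₀)) L≤2+K)

    hits-between : ∀ {m} → ∣ A ∣ ≡ suc (m + m) → Between (suc m) (hits 0) (hits K)
    hits-between {m} ∣A∣≡1+2m = +<+⇒<⊎< lower , Sum.map s≤s⁻¹ s≤s⁻¹ (+<+⇒<⊎< upper)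
      where
      lower : m + m < hits 0 + hits K
      lower = subst (_≤ hits 0 + hits K) ∣A∣≡1+2m ∣A∣≤hits0+hitsK
      upper : hits 0 + hits K < suc (suc m) + suc (suc m)
      upper = s≤s (≤-trans hits0+hitsK≤∣A∣+2 (≤-reflexive (trans (cong (_+ 2) ∣A∣≡1+2m) (rearrange m))))
        where
        rearrange : ∀ m → suc (m + m) + 2 ≡ suc m + suc (suc m)
        rearrange = solve-∀

  windows : List (Subset n)
  windows = map (window ∘ toℕ) (allFin (suc K))

  windows-length : length windows ≡ suc K
  windows-length = trans (length-map _ (allFin (suc K))) (length-tabulate (λ i → i))

  window-∈ : ∀ {s} → s ≤ K → window s ∈ₗ windows
  window-∈ {s} s≤K =
    subst (_∈ₗ windows) (cong window (toℕ-fromℕ< (s≤s s≤K))) (∈-map⁺ (window ∘ toℕ) (∈-allFin (fromℕ< (s≤s s≤K))))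

  window-start : ∀ {s t} → s < n → window s ⊆ window t → t ≤ s
  window-start {s} {t} s<n Wₛ⊆Wₜ = subst (t ≤_) i≡s (proj₁ (∈-interval⁻ (Wₛ⊆Wₜ i∈Wₛ)))
    where
    i = fromℕ< s<n
    i≡s : toℕ i ≡ s
    i≡s = toℕ-fromℕ< s<n
    i∈Wₛ : i ∈ window s
    i∈Wₛ = ∈-interval⁺ (≤-reflexive (sym i≡s)) (subst (_< s + L) (sym i≡s) (m<m+n s 0<L))

  windows-unique : Unique windows
  windows-unique = Unique.map⁺ injective (Unique.allFin⁺ (suc K))
    where
    K<n : K < n
    K<n = subst (K <_) K+L≡n (m<m+n K 0<L)
    injective : ∀ {s t : Fin (suc K)} → window (toℕ s) ≡ window (toℕ t) → s ≡ t
    injective {s} {t} Wₛ≡Wₜ = toℕ-injective (≤-antisym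
      (window-start (<-≤-trans (toℕ<n t) K<n) (⊆-reflexive (sym Wₛ≡Wₜ)))
      (window-start (<-≤-trans (toℕ<n s) K<n) (⊆-reflexive Wₛ≡Wₜ)))

  windows-secting : DSecting One OddSet windows
  windows-secting A odd =
    let s , s≤K , hits≡1+m =
          discrete-intermediate-value (hits A) (hits-suc≤ A) (hits≤suc A) K (hits-between A {m} ∣A∣≡1+2m)
    in  window s , window-∈ s≤K , sectVal≡1 A (window s) {m} ∣A∣≡1+2m hits≡1+m
    where
    m = ∣ A ∣ / 2
    ∣A∣≡1+2m : ∣ A ∣ ≡ suc (m + m)
    ∣A∣≡1+2m = k%2≡1⇒k≡1+[k/2+k/2] odd

evenSizeFactors : ∀ {n} → ℕ → List (Affine n)
evenSizeFactors h = map (λ j → sizeMinus (suc j + suc j)) (upTo h)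

length-evenSizeFactors : ∀ {n} h → length (evenSizeFactors {n} h) ≡ h
length-evenSizeFactors h = trans (length-map _ (upTo h)) (length-upTo h)

evenSizeFactors-⊥ : ∀ {n} h → All (λ L → ¬ ⟦ L ⟧ ⊥ ≡ 0ℤ) (evenSizeFactors {n} h)
evenSizeFactors-⊥ {n} h =
  All.map⁺ (universal (λ j → (λ ()) ∘ trans (sym (⟦sizeMinus⟧-⊥ {n} (suc j + suc j)))) (upTo h))

sectFactors-⊥ : ∀ {n} (F' : List (Subset n)) → All (λ L → ¬ ⟦ L ⟧ ⊥ ≡ 0ℤ) (map sectAffine F')
sectFactors-⊥ F' = All.map⁺ (universal (λ A → (λ ()) ∘ trans (sym (⟦sectAffine⟧-⊥ A))) F')

evenSizeFactors-root : ∀ {n} (x : Subset n) → ¬ x ≡ ⊥ → ¬ OddSet x →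
                       Any (λ L → ⟦ L ⟧ x ≡ 0ℤ) (evenSizeFactors ⌊ n /2⌋)
evenSizeFactors-root {n} x x≢⊥ even = root (∣ x ∣ / 2) (k%2≢1⇒k≡k/2+k/2 even)
  where
  root : ∀ j → ∣ x ∣ ≡ j + j → Any (λ L → ⟦ L ⟧ x ≡ 0ℤ) (evenSizeFactors ⌊ n /2⌋)
  root zero    ∣x∣≡0    = contradiction (∣p∣≡0⇒p≡⊥ ∣x∣≡0) x≢⊥
  root (suc j) ∣x∣≡2+2j = Any.map⁺ (lose (∈-upTo⁺ j<⌊n/2⌋) ⟦L⟧x≡0)
    where
    j<⌊n/2⌋ : j < ⌊ n /2⌋
    j<⌊n/2⌋ = subst (_≤ ⌊ n /2⌋) (sym (n≡⌊n+n/2⌋ (suc j))) (⌊n/2⌋-mono (subst (_≤ n) ∣x∣≡2+2j (∣p∣≤n x)))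
    ⟦L⟧x≡0 : ⟦ sizeMinus (suc j + suc j) ⟧ x ≡ 0ℤ
    ⟦L⟧x≡0 = trans (⟦sizeMinus⟧ _ x)
                   (trans (cong (λ k → ℤ.+ k ℤ.- ℤ.+ (suc j + suc j)) ∣x∣≡2+2j) (ℤ.+-inverseʳ (ℤ.+ (suc j + suc j))))

lower-bound : ∀ {n} (F' : List (Subset n)) → DSecting One OddSet F' → ⌈ n /2⌉ ≤ length F'
lower-bound {n} F' secting = ≮⇒≥ (λ short → P⊥≢0 (P⊥≡0 short))
  where
  factors : List (Affine n)
  factors = evenSizeFactors ⌊ n /2⌋ ++ map sectAffine F'

  P : Subset n → ℤ.ℤ
  P = ∏ factors

  P⊥≢0 : ¬ P ⊥ ≡ 0ℤ
  P⊥≢0 = ∏-nonzero (All.++⁺ (evenSizeFactors-⊥ ⌊ n /2⌋) (sectFactors-⊥ F'))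

  vanishes-off-⊥ : ∀ x → ¬ x ≡ ⊥ → P x ≡ 0ℤ
  vanishes-off-⊥ x x≢⊥ with ∣ x ∣ % 2 ≟ 1
  ... | yes odd  =
    let A' , A'∈F' , sect≡1 = secting x odd
    in  ∏-zero (Any.++⁺ʳ (evenSizeFactors ⌊ n /2⌋)
                 (Any.map⁺ (lose A'∈F' (trans (⟦sectAffine⟧ A' x) (cong (ℤ._- 1ℤ) sect≡1)))))
  ... | no  even = ∏-zero (Any.++⁺ˡ (evenSizeFactors-root x x≢⊥ even))

  few-factors : length F' < ⌈ n /2⌉ → length factors < n
  few-factors short = begin-strict
    length factors
      ≡⟨ length-++ (evenSizeFactors ⌊ n /2⌋) ⟩
    length (evenSizeFactors {n} ⌊ n /2⌋) + length (map sectAffine F')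
      ≡⟨ cong₂ _+_ (length-evenSizeFactors ⌊ n /2⌋) (length-map sectAffine F') ⟩
    ⌊ n /2⌋ + length F'
      <⟨ +-monoʳ-< ⌊ n /2⌋ short ⟩
    ⌊ n /2⌋ + ⌈ n /2⌉
      ≡⟨ ⌊n/2⌋+⌈n/2⌉≡n n ⟩
    n ∎
    where open ≤-Reasoning

  P⊥≡0 : length F' < ⌈ n /2⌉ → P ⊥ ≡ 0ℤ
  P⊥≡0 short = begin
    P ⊥              ≡⟨ alternatingSum-point P vanishes-off-⊥ ⟨
    alternatingSum P ≡⟨ alternatingSum-vanishes (∏-degree factors) (few-factors short) ⟩
    0ℤ               ∎
    where open ≡-Reasoning

theorem8 : (n : ℕ) → 1 ≤ n → Beta1Is n ⌈ n /2⌉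
-- ⌈ 1 + n /2⌉ computes to 1 + ⌊ n /2⌋, the number of windows.
theorem8 (suc n) _ = (windows , windows-unique , windows-length , windows-secting) , lower-bound
  where
  open SlidingWindows ⌊ n /2⌋ (suc ⌈ n /2⌉)
         (trans (+-suc ⌊ n /2⌋ ⌈ n /2⌉) (cong suc (⌊n/2⌋+⌈n/2⌉≡n n)))
         (≤-trans (⌊n/2⌋≤⌈n/2⌉ n) (n≤1+n ⌈ n /2⌉))
         (s≤s (⌊n/2⌋-mono (n≤1+n (suc n))))
         (s≤s z≤n)
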